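{- For every simple connected graph $G=(V,E)$, $\lfloor \mathrm{MAD}(G) + 1 \rfloor \leq \left\lfloor \frac{3 + \sqrt{9 + 8(|E| - |V|)}}{2} \right\rfloor$.
   Context: All graphs are finite, simple and undirected. The average degree of a graph $H$ is $d(H)=\frac{2|E(H)|}{|V(H)|}$ if $V(H)\neq\emptyset$ and $d(H)=0$ for the null graph. $\mathrm{MAD}(G)$ is the maximum of $d(H)$ over all subgraphs $H$ of $G$. -}

module Defs where

open import Data.Nat using (ℕ; zero; suc; _+_; _*_; _∸_; _≤_; _<_; _<ᵇ_)
open import Data.Bool using (Bool; true; false; if_then_else_; _∧_)
open import Data.Fin using (Fin; toℕ)
open import Data.List using (List; map; allFin)
open import Data.Nat.ListAction using (sum)
open import Data.Product using (Σ; _×_; ∃)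
open import Data.Integer using (ℤ; +_)
open import Data.Rational using (ℚ; 0ℚ; _/_)
import Data.Rational as ℚ
open import Relation.Binary.PropositionalEquality using (_≡_)

record Graph : Set where
  field
    n      : ℕ
    adj    : Fin n → Fin n → Bool
    sym    : ∀ i j → adj i j ≡ adj j i
    irrefl : ∀ i → adj i i ≡ false
open Graph public

countV : ∀ {n} → (Fin n → Bool) → ℕ
countV {n} s = sum (map (λ i → if s i then 1 else 0) (allFin n))

countE : ∀ {n} → (Fin n → Fin n → Bool) → ℕ
countE {n} a =
  sum (map (λ i → sum (map (λ j → if (toℕ i <ᵇ toℕ j) ∧ a i j then 1 else 0)
                           (allFin n)))
           (allFin n))

|V| : Graph → ℕ
|V| G = n G

|E| : Graph → ℕ
|E| G = countE (adj G)

data Reach (G : Graph) : Fin (n G) → Fin (n G) → Set where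
  here : ∀ {i} → Reach G i i
  step : ∀ {i j k} → adj G i j ≡ true → Reach G j k → Reach G i k

Connected : Graph → Set
Connected G = ∀ i j → Reach G i j

record Subgraph (G : Graph) : Set where
  field
    vs     : Fin (n G) → Bool
    es     : Fin (n G) → Fin (n G) → Bool
    es-sym : ∀ i j → es i j ≡ es j i
    es-sub : ∀ i j → es i j ≡ true →
             (adj G i j ≡ true) × (vs i ≡ true) × (vs j ≡ true)
open Subgraph public

-- average degree d(H) = 2|E(H)|/|V(H)|, and 0 for the null graph
avgDeg' : ℕ → ℕ → ℚ
avgDeg' e zero    = 0ℚ
avgDeg' e (suc v) = (+ (2 * e)) / suc v

avgDeg : ∀ {G} → Subgraph G → ℚ
avgDeg H = avgDeg' (countE (es H)) (countV (vs H))

IsMAD : Graph → ℚ → Set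
IsMAD G q = (∃ λ (H : Subgraph G) → avgDeg H ≡ q) × (∀ (H : Subgraph G) → avgDeg H ℚ.≤ q)

IsFloorSqrt : ℕ → ℕ → Set
IsFloorSqrt N r = (r * r ≤ N) × (N < suc r * suc r)

-- Let H have v vertices and e edges.  It has at most v(v − 1)/2 edges, so 2e + v ≤ v²; and as G is
-- connected, growing the vertex set of H along boundary edges shows that every vertex outside H
-- brings at least one further edge of G, so e + n ≤ |E| + v.  Put m = ⌊(3 + r)/2⌋, which is ≥ 2
-- because n ≤ |E| + 1 forces r ≥ 1.  If ⌊2e/v + 1⌋ > m then m v ≤ 2e, hence v ≥ m + 1 and
-- 2(|E| − n) ≥ 2e − 2v ≥ (m − 2) v ≥ (m − 2)(m + 1), i.e. (2m − 1)² ≤ 9 + 8(|E| − n).  So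
-- 2m − 1 ≤ r, contradicting 3 + r ≤ 2m + 1.  Below m = 2 + p, so 2m − 1 = 2p + 3.
module Submission where

open import Defs hiding (sym)
open import Data.Nat using (ℕ; _+_; _*_; _∸_; _/_; zero; suc; _≤_; _<_; _<ᵇ_; z≤n; s≤s; _≤?_; NonZero; >-nonZero)
open import Data.Nat.Properties hiding (_≟_)
open import Data.Nat.DivMod using (_%_; m≡m%n+[m/n]*n; m%n<n; m≥n⇒m/n>0)
open import Data.Nat.ListAction using (sum)
open import Data.Nat.Tactic.RingSolver using (solve-∀)
open import Data.Integer using (+_)
import Data.Integer as ℤ
import Data.Integer.Properties as ℤ
import Data.Integer.DivMod as ℤ
open import Data.Integer.GCD using (gcd)
import Data.Integer.Tactic.RingSolver as ℤ
open import Data.Rational using (ℚ; mkℚ; ↥_; ↧_; floor; 1ℚ)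
import Data.Rational as ℚ
open import Data.Rational.Properties using (↥-/; ↧-/)
open import Data.Bool using (Bool; true; false; if_then_else_; _∧_; _∨_)
open import Data.Bool.Properties using (∧-comm; ∧-zeroʳ; ∨-zeroʳ; ∨-identityʳ)
open import Data.Fin using (Fin; zero; suc; toℕ)
open import Data.Fin.Properties using (_≟_; toℕ-injective)
open import Data.List using (map; allFin)
open import Data.List.Properties using (map-tabulate; map-cong)
open import Data.Product using (∃; ∃₂; _×_; _,_)
open import Function using (_∘_; id)
open import Relation.Nullary using (does; yes; no; contradiction)
open import Relation.Nullary.Decidable using (dec-true)
open import Relation.Binary.Definitions using (Tri; tri<; tri≈; tri>)
open import Relation.Binary.PropositionalEquality

𝟙 : Bool → ℕ
𝟙 b = if b then 1 else 0

∑ : ∀ {n} → (Fin n → ℕ) → ℕ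
∑ {n} f = sum (map f (allFin n))

∑-suc : ∀ {n} (f : Fin (suc n) → ℕ) → ∑ f ≡ f zero + ∑ (f ∘ suc)
∑-suc f = cong (λ fs → f zero + sum fs)
  (trans (map-tabulate suc f) (sym (map-tabulate id (f ∘ suc))))

∑-cong : ∀ {n} {f g : Fin n → ℕ} → (∀ i → f i ≡ g i) → ∑ f ≡ ∑ g
∑-cong {n} f≗g = cong sum (map-cong f≗g (allFin n))

∑-zero : ∀ n → ∑ {n} (λ _ → 0) ≡ 0
∑-zero zero    = refl
∑-zero (suc n) = trans (∑-suc {n} (λ _ → 0)) (∑-zero n)

∑-mono-≤ : ∀ {n} {f g : Fin n → ℕ} → (∀ i → f i ≤ g i) → ∑ f ≤ ∑ g
∑-mono-≤ {zero}  f≤g = z≤n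
∑-mono-≤ {suc n} {f} {g} f≤g rewrite ∑-suc f | ∑-suc g =
  +-mono-≤ (f≤g zero) (∑-mono-≤ (f≤g ∘ suc))

∑-mono-< : ∀ {n} {f g : Fin n → ℕ} → (∀ i → f i ≤ g i) → ∀ x → f x < g x → ∑ f < ∑ g
∑-mono-< {suc n} {f} {g} f≤g zero f₀<g₀ rewrite ∑-suc f | ∑-suc g =
  +-mono-<-≤ f₀<g₀ (∑-mono-≤ (f≤g ∘ suc))
∑-mono-< {suc n} {f} {g} f≤g (suc x) fx<gx rewrite ∑-suc f | ∑-suc g =
  +-mono-≤-< (f≤g zero) (∑-mono-< (f≤g ∘ suc) x fx<gx)

∑-distrib-+ : ∀ {n} (f g : Fin n → ℕ) → ∑ (λ i → f i + g i) ≡ ∑ f + ∑ g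
∑-distrib-+ {zero}  f g = refl
∑-distrib-+ {suc n} f g = begin
  ∑ (λ i → f i + g i)                              ≡⟨ ∑-suc (λ i → f i + g i) ⟩
  f zero + g zero + ∑ (λ i → f (suc i) + g (suc i)) ≡⟨ cong (_+_ (f zero + g zero)) (∑-distrib-+ (f ∘ suc) (g ∘ suc)) ⟩
  f zero + g zero + (∑ (f ∘ suc) + ∑ (g ∘ suc))     ≡⟨ +-+-interchange (f zero) (g zero) _ _ ⟩
  (f zero + ∑ (f ∘ suc)) + (g zero + ∑ (g ∘ suc))   ≡⟨ sym (cong₂ _+_ (∑-suc f) (∑-suc g)) ⟩
  ∑ f + ∑ g                                         ∎
  where
  open ≡-Reasoning
  +-+-interchange : ∀ a b c d → a + b + (c + d) ≡ (a + c) + (b + d)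
  +-+-interchange = solve-∀

countV-suc : ∀ {n} (s : Fin (suc n) → Bool) → countV s ≡ 𝟙 (s zero) + countV (s ∘ suc)
countV-suc s = ∑-suc (𝟙 ∘ s)

countV<n⇒∃false : ∀ {n} (s : Fin n → Bool) → countV s < n → ∃ λ t → s t ≡ false
countV<n⇒∃false {suc n} s |s|<n rewrite countV-suc s with s zero in s₀
... | false = zero , s₀
... | true  with countV<n⇒∃false (s ∘ suc) (≤-pred |s|<n)
...   | t , st = suc t , st

0<countV⇒∃true : ∀ {n} (s : Fin n → Bool) → 0 < countV s → ∃ λ t → s t ≡ true
0<countV⇒∃true {suc n} s 0<|s| rewrite countV-suc s with s zero in s₀
... | true  = zero , s₀
... | false with 0<countV⇒∃true (s ∘ suc) 0<|s|
...   | t , st = suc t , st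

｛_｝ : ∀ {n} → Fin n → Fin n → Bool
｛ x ｝ i = does (i ≟ x)

_∪｛_｝ : ∀ {n} → (Fin n → Bool) → Fin n → Fin n → Bool
(s ∪｛ x ｝) i = s i ∨ ｛ x ｝ i

countV-｛｝ : ∀ {n} (x : Fin n) → countV ｛ x ｝ ≡ 1
countV-｛｝ {suc n} zero    = trans (countV-suc {n} ｛ zero ｝) (cong suc (∑-zero n))
countV-｛｝ {suc n} (suc x) = trans (countV-suc {n} ｛ suc x ｝) (countV-｛｝ x)

countV-∪｛｝ : ∀ {n} (s : Fin n → Bool) x → s x ≡ false → countV (s ∪｛ x ｝) ≡ suc (countV s)
countV-∪｛｝ s x sx = begin
  countV (s ∪｛ x ｝)               ≡⟨ ∑-cong disjoint ⟩
  ∑ (λ i → 𝟙 (s i) + 𝟙 (｛ x ｝ i)) ≡⟨ ∑-distrib-+ (𝟙 ∘ s) (𝟙 ∘ ｛ x ｝) ⟩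
  countV s + countV ｛ x ｝         ≡⟨ cong (_+_ (countV s)) (countV-｛｝ x) ⟩
  countV s + 1                     ≡⟨ +-comm (countV s) 1 ⟩
  suc (countV s)                   ∎
  where
  open ≡-Reasoning
  disjoint : ∀ i → 𝟙 ((s ∪｛ x ｝) i) ≡ 𝟙 (s i) + 𝟙 (｛ x ｝ i)
  disjoint i with i ≟ x
  ... | yes refl rewrite sx = refl
  ... | no _     rewrite ∨-identityʳ (s i) = sym (+-identityʳ (𝟙 (s i)))

Relᵇ : ℕ → Set
Relᵇ n = Fin n → Fin n → Bool

_⊆_ : ∀ {n} → Relᵇ n → Relᵇ n → Set
a ⊆ b = ∀ i j → a i j ≡ true → b i j ≡ true

Symmetricᵇ : ∀ {n} → Relᵇ n → Set
Symmetricᵇ a = ∀ i j → a i j ≡ a j i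

-- countE a unfolds to ∑ λ i → ∑ (aboveDiagonal a i), as countV s does to ∑ (𝟙 ∘ s).
aboveDiagonal : ∀ {n} → Relᵇ n → Fin n → Fin n → ℕ
aboveDiagonal a i j = 𝟙 ((toℕ i <ᵇ toℕ j) ∧ a i j)

aboveDiagonal-mono : ∀ {n} {a b : Relᵇ n} → a ⊆ b → ∀ i j → aboveDiagonal a i j ≤ aboveDiagonal b i j
aboveDiagonal-mono {a = a} a⊆b i j with toℕ i <ᵇ toℕ j | a i j in aij
... | false | _     = z≤n
... | true  | false = z≤n
... | true  | true  rewrite a⊆b i j aij = ≤-refl

countE-mono : ∀ {n} {a b : Relᵇ n} → a ⊆ b → countE a ≤ countE b
countE-mono a⊆b = ∑-mono-≤ λ i → ∑-mono-≤ (aboveDiagonal-mono a⊆b i)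

countE-mono-< : ∀ {n} {a b : Relᵇ n} → a ⊆ b → Symmetricᵇ a → Symmetricᵇ b →
  ∀ {i j} → i ≢ j → a i j ≡ false → b i j ≡ true → countE a < countE b
countE-mono-< {a = a} {b} a⊆b a-sym b-sym {i} {j} i≢j aij bij = by-order (<-cmp (toℕ i) (toℕ j))
  where
  above : ∀ x y → toℕ x < toℕ y → a x y ≡ false → b x y ≡ true → countE a < countE b
  above x y x<y axy bxy = ∑-mono-< (λ i → ∑-mono-≤ (aboveDiagonal-mono a⊆b i)) x
    (∑-mono-< (aboveDiagonal-mono a⊆b x) y gap)
    where
    gap : aboveDiagonal a x y < aboveDiagonal b x y
    gap with toℕ x <ᵇ toℕ y | <⇒<ᵇ x<y
    ... | true | _ rewrite axy | bxy = s≤s z≤n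

  by-order : Tri (toℕ i < toℕ j) (toℕ i ≡ toℕ j) (toℕ j < toℕ i) → countE a < countE b
  by-order (tri< i<j _ _) = above i j i<j aij bij
  by-order (tri≈ _ i≡j _) = contradiction (toℕ-injective i≡j) i≢j
  by-order (tri> _ _ j<i) = above j i j<i (trans (a-sym j i) aij) (trans (b-sym j i) bij)

countE-suc : ∀ {n} (a : Relᵇ (suc n)) →
  countE a ≡ countV (a zero ∘ suc) + countE (λ i j → a (suc i) (suc j))
countE-suc a = trans (∑-suc (λ i → ∑ (aboveDiagonal a i)))
  (cong₂ _+_ (∑-suc (aboveDiagonal a zero)) (∑-cong λ i → ∑-suc (aboveDiagonal a (suc i))))

clique : ∀ {n} → (Fin n → Bool) → Relᵇ n
clique s i j = s i ∧ s j

countE-clique : ∀ {n} (s : Fin n → Bool) → 2 * countE (clique s) + countV s ≡ countV s * countV s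
countE-clique {zero}  s = refl
countE-clique {suc n} s rewrite countE-suc (clique s) | countV-suc s with s zero
... | false rewrite ∑-zero n = countE-clique (s ∘ suc)
... | true  = begin
  2 * (c + k) + suc c   ≡⟨ regroup c k ⟩
  (2 * k + c) + (2 * c + 1) ≡⟨ cong (_+ (2 * c + 1)) (countE-clique (s ∘ suc)) ⟩
  c * c + (2 * c + 1)   ≡⟨ square-suc c ⟩
  suc c * suc c         ∎
  where
  open ≡-Reasoning
  c = countV (s ∘ suc)
  k = countE (clique (s ∘ suc))
  regroup : ∀ c k → 2 * (c + k) + suc c ≡ (2 * k + c) + (2 * c + 1)
  regroup = solve-∀
  square-suc : ∀ c → c * c + (2 * c + 1) ≡ suc c * suc c
  square-suc = solve-∀

induced : (G : Graph) → (Fin (n G) → Bool) → Relᵇ (n G)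
induced G s i j = clique s i j ∧ adj G i j

induced⊆adj : ∀ G s → induced G s ⊆ adj G
induced⊆adj G s i j e with clique s i j
... | true = e

induced-sym : ∀ G s → Symmetricᵇ (induced G s)
induced-sym G s i j = cong₂ _∧_ (∧-comm (s i) (s j)) (Graph.sym G i j)

countE-induced-∪｛｝ : ∀ G s {i j} → adj G i j ≡ true → s i ≡ true → s j ≡ false →
  countE (induced G s) < countE (induced G (s ∪｛ j ｝))
countE-induced-∪｛｝ G s {i} {j} ij si sj =
  countE-mono-< grows (induced-sym G s) (induced-sym G (s ∪｛ j ｝)) i≢j before after
  where
  grows : induced G s ⊆ induced G (s ∪｛ j ｝)
  grows x y e with s x | s y
  ... | true | true = e
  i≢j : i ≢ j
  i≢j refl = contradiction (trans (sym si) sj) λ ()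
  before : induced G s i j ≡ false
  before rewrite sj | ∧-zeroʳ (s i) = refl
  after : induced G (s ∪｛ j ｝) i j ≡ true
  after rewrite si | dec-true (j ≟ j) refl | ∨-zeroʳ (s j) = ij

boundary-edge : ∀ {G} (s : Fin (n G) → Bool) {a b} → Reach G a b → s a ≡ true → s b ≡ false →
  ∃₂ λ i j → adj G i j ≡ true × s i ≡ true × s j ≡ false
boundary-edge s here          sa sb = contradiction (trans (sym sa) sb) λ ()
boundary-edge s (step {j = j} aj r) sa sb with s j in sj
... | true  = boundary-edge s r sj sb
... | false = _ , j , aj , sa , sj

countE-induced+n≤|E|+countV : ∀ G → Connected G → ∀ s {a} → s a ≡ true →
  countE (induced G s) + n G ≤ |E| G + countV s
countE-induced+n≤|E|+countV G conn s {a} sa = grow (n G) s (m≤n+m (n G) (countV s)) sa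
  where
  grow : ∀ k s → n G ≤ countV s + k → s a ≡ true → countE (induced G s) + n G ≤ |E| G + countV s
  grow k s n≤|s|+k sa with n G ≤? countV s
  ... | yes n≤|s| = +-mono-≤ (countE-mono (induced⊆adj G s)) n≤|s|
  grow zero s n≤|s|+0 sa | no n≰|s| = contradiction (subst (n G ≤_) (+-identityʳ _) n≤|s|+0) n≰|s|
  grow (suc k) s n≤|s|+k sa | no n≰|s| with countV<n⇒∃false s (≰⇒> n≰|s|)
  ... | t , st with boundary-edge s (conn a t) sa st
  ... | i , j , ij , si , sj = ≤-pred (begin
    suc (countE (induced G s) + n G) ≤⟨ +-monoˡ-≤ (n G) (countE-induced-∪｛｝ G s ij si sj) ⟩
    countE (induced G s′) + n G      ≤⟨ grow k s′ n≤|s′|+k (cong (_∨ _) sa) ⟩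
    |E| G + countV s′                ≡⟨ cong (_+_ (|E| G)) |s′| ⟩
    |E| G + suc (countV s)           ≡⟨ +-suc (|E| G) (countV s) ⟩
    suc (|E| G + countV s)           ∎)
    where
    open ≤-Reasoning
    s′ = s ∪｛ j ｝
    |s′| : countV s′ ≡ suc (countV s)
    |s′| = countV-∪｛｝ s j sj
    n≤|s′|+k : n G ≤ countV s′ + k
    n≤|s′|+k = begin
      n G                  ≤⟨ n≤|s|+k ⟩
      countV s + suc k     ≡⟨ +-suc (countV s) k ⟩
      suc (countV s) + k   ≡⟨ cong (_+ k) |s′| ⟨
      countV s′ + k        ∎

n≤|E|+1 : ∀ G → Connected G → Fin (n G) → n G ≤ |E| G + 1
n≤|E|+1 G conn a = begin
  n G                               ≤⟨ m≤n+m (n G) _ ⟩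
  countE (induced G ｛ a ｝) + n G  ≤⟨ countE-induced+n≤|E|+countV G conn ｛ a ｝ {a} a∈｛a｝ ⟩
  |E| G + countV ｛ a ｝            ≡⟨ cong (_+_ (|E| G)) (countV-｛｝ a) ⟩
  |E| G + 1                         ∎
  where
  open ≤-Reasoning
  a∈｛a｝ : ｛ a ｝ a ≡ true
  a∈｛a｝ = dec-true (a ≟ a) refl

es⊆induced : ∀ {G} (H : Subgraph G) → es H ⊆ induced G (vs H)
es⊆induced H i j e with es-sub H i j e
... | ij , si , sj rewrite si | sj = ij

es⊆clique : ∀ {G} (H : Subgraph G) → es H ⊆ clique (vs H)
es⊆clique H i j e with es-sub H i j e
... | _ , si , sj rewrite si | sj = refl

subgraph-e+n≤|E|+v : ∀ G → Connected G → (H : Subgraph G) → ∀ {a} → vs H a ≡ true →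
  countE (es H) + n G ≤ |E| G + countV (vs H)
subgraph-e+n≤|E|+v G conn H a∈H = ≤-trans (+-monoˡ-≤ (n G) (countE-mono (es⊆induced H)))
  (countE-induced+n≤|E|+countV G conn (vs H) a∈H)

subgraph-2e+v≤v² : ∀ {G} (H : Subgraph G) → 2 * countE (es H) + countV (vs H) ≤ countV (vs H) * countV (vs H)
subgraph-2e+v≤v² H = ≤-trans (+-monoˡ-≤ (countV (vs H)) (*-monoʳ-≤ 2 (countE-mono (es⊆clique H))))
  (≤-reflexive (countE-clique (vs H)))

≤[m/2]*2+1 : ∀ m → m ≤ m / 2 * 2 + 1
≤[m/2]*2+1 m = begin
  m                  ≡⟨ m≡m%n+[m/n]*n m 2 ⟩
  m % 2 + m / 2 * 2  ≤⟨ +-monoˡ-≤ (m / 2 * 2) (≤-pred (m%n<n m 2)) ⟩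
  1 + m / 2 * 2      ≡⟨ +-comm 1 (m / 2 * 2) ⟩
  m / 2 * 2 + 1      ∎
  where open ≤-Reasoning

floorSqrt-maximal : ∀ {N r} → IsFloorSqrt N r → ∀ q → q * q ≤ N → q ≤ r
floorSqrt-maximal (_ , N<[1+r]²) q q²≤N =
  ≮⇒≥ λ r<q → <⇒≱ N<[1+r]² (≤-trans (*-mono-≤ r<q r<q) q²≤N)

floorSqrt-pos : ∀ {N r} → IsFloorSqrt N r → 0 < N → 0 < r
floorSqrt-pos {r = zero}  (_ , N<1) 0<N = contradiction 0<N (<⇒≱ N<1)
floorSqrt-pos {r = suc r} _         _   = s≤s z≤n

[2p+3]²+8n≤9+8E : ∀ {E n v e} p .{{_ : NonZero v}} →
  (2 + p) * v ≤ 2 * e → 2 * e + v ≤ v * v → e + n ≤ E + v →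
  (2 * p + 3) * (2 * p + 3) + 8 * n ≤ 9 + 8 * E
[2p+3]²+8n≤9+8E {E} {n} {v} {e} p [2+p]v≤2e 2e+v≤v² e+n≤E+v = begin
  (2 * p + 3) * (2 * p + 3) + 8 * n  ≡⟨ expand p n ⟩
  4 * (p * (3 + p) + 2 * n) + 9      ≤⟨ +-monoˡ-≤ 9 (*-monoʳ-≤ 4 p[3+p]+2n≤2E) ⟩
  4 * (2 * E) + 9                    ≡⟨ collect E ⟩
  9 + 8 * E                          ∎
  where
  open ≤-Reasoning
  expand : ∀ p n → (2 * p + 3) * (2 * p + 3) + 8 * n ≡ 4 * (p * (3 + p) + 2 * n) + 9
  expand = solve-∀
  collect : ∀ E → 4 * (2 * E) + 9 ≡ 9 + 8 * E
  collect = solve-∀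
  regroup : ∀ v p n → 2 * v + (p * v + 2 * n) ≡ (2 + p) * v + 2 * n
  regroup = solve-∀
  swap : ∀ E v → 2 * (E + v) ≡ 2 * v + 2 * E
  swap = solve-∀

  3+p≤v : 3 + p ≤ v
  3+p≤v = *-cancelʳ-≤ (3 + p) v v (begin
    v + (2 + p) * v  ≤⟨ +-monoʳ-≤ v [2+p]v≤2e ⟩
    v + 2 * e        ≡⟨ +-comm v (2 * e) ⟩
    2 * e + v        ≤⟨ 2e+v≤v² ⟩
    v * v            ∎)

  p[3+p]+2n≤2E : p * (3 + p) + 2 * n ≤ 2 * E
  p[3+p]+2n≤2E = +-cancelˡ-≤ (2 * v) _ _ (begin
    2 * v + (p * (3 + p) + 2 * n)  ≤⟨ +-monoʳ-≤ (2 * v) (+-monoˡ-≤ (2 * n) (*-monoʳ-≤ p 3+p≤v)) ⟩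
    2 * v + (p * v + 2 * n)        ≡⟨ regroup v p n ⟩
    (2 + p) * v + 2 * n            ≤⟨ +-monoˡ-≤ (2 * n) [2+p]v≤2e ⟩
    2 * e + 2 * n                  ≡⟨ *-distribˡ-+ 2 e n ⟨
    2 * (e + n)                    ≤⟨ *-monoʳ-≤ 2 e+n≤E+v ⟩
    2 * (E + v)                    ≡⟨ swap E v ⟩
    2 * v + 2 * E                  ∎)

2e<m*v : ∀ {E n v e r} m → IsFloorSqrt ((9 + 8 * E) ∸ 8 * n) r → 3 + r ≤ m * 2 + 1 →
  0 < v → n ≤ E + 1 → e + n ≤ E + v → 2 * e + v ≤ v * v → 2 * e < m * v
2e<m*v zero                _  (s≤s ()) _ _ _ _
2e<m*v {E} {n} (suc zero)  √N (s≤s (s≤s (s≤s r≤0))) _ n≤E+1 _ _ =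
  contradiction (floorSqrt-pos √N 0<N) (≤⇒≯ r≤0)
  where
  distrib : ∀ E → 8 * (E + 1) ≡ 8 + 8 * E
  distrib = solve-∀
  0<N : 0 < (9 + 8 * E) ∸ 8 * n
  0<N = m<n⇒0<n∸m (s≤s (≤-trans (*-monoʳ-≤ 8 n≤E+1) (≤-reflexive (distrib E))))
2e<m*v {E} {n} {v} {e} {r} (suc (suc p)) √N 3+r≤2m+1 0<v _ e+n≤E+v 2e+v≤v² =
  ≰⇒> λ mv≤2e → <⇒≱ (2m+1<3+r mv≤2e) 3+r≤2m+1
  where
  instance _ = >-nonZero 0<v
  regroup : ∀ p → suc ((2 + p) * 2 + 1) ≡ 3 + (2 * p + 3)
  regroup = solve-∀
  2m+1<3+r : (2 + p) * v ≤ 2 * e → (2 + p) * 2 + 1 < 3 + r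
  2m+1<3+r mv≤2e = begin
    suc ((2 + p) * 2 + 1)  ≡⟨ regroup p ⟩
    3 + (2 * p + 3)        ≤⟨ +-monoʳ-≤ 3 (floorSqrt-maximal √N (2 * p + 3) [2p+3]²≤N) ⟩
    3 + r                  ∎
    where
    open ≤-Reasoning
    [2p+3]²≤N : (2 * p + 3) * (2 * p + 3) ≤ (9 + 8 * E) ∸ 8 * n
    [2p+3]²≤N = m+n≤o⇒m≤o∸n _ ([2p+3]²+8n≤9+8E {E} {n} {v} {e} p mv≤2e 2e+v≤v² e+n≤E+v)

↥[i/n]*n≡i*↧[i/n] : ∀ i n .{{_ : NonZero n}} → ↥ (i ℚ./ n) ℤ.* + n ≡ i ℤ.* ↧ (i ℚ./ n)
↥[i/n]*n≡i*↧[i/n] i n = begin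
  ↥ (i ℚ./ n) ℤ.* + n                  ≡⟨ cong (↥ (i ℚ./ n) ℤ.*_) (↧-/ i n) ⟨
  ↥ (i ℚ./ n) ℤ.* (↧ (i ℚ./ n) ℤ.* g)  ≡⟨ swap (↥ (i ℚ./ n)) (↧ (i ℚ./ n)) g ⟩
  ↥ (i ℚ./ n) ℤ.* g ℤ.* ↧ (i ℚ./ n)    ≡⟨ cong (ℤ._* ↧ (i ℚ./ n)) (↥-/ i n) ⟩
  i ℤ.* ↧ (i ℚ./ n)                    ∎
  where
  open ≡-Reasoning
  g = gcd i (+ n)
  swap : ∀ a b c → a ℤ.* (b ℤ.* c) ≡ a ℤ.* c ℤ.* b
  swap = ℤ.solve-∀

i<k*n⇒↥[i/n]<k*↧[i/n] : ∀ i n .{{_ : NonZero n}} k → i ℤ.< k ℤ.* + n → ↥ (i ℚ./ n) ℤ.< k ℤ.* ↧ (i ℚ./ n)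
i<k*n⇒↥[i/n]<k*↧[i/n] i n k i<kn = ℤ.*-cancelʳ-<-nonNeg (+ n) (begin-strict
  ↥ (i ℚ./ n) ℤ.* + n        ≡⟨ ↥[i/n]*n≡i*↧[i/n] i n ⟩
  i ℤ.* ↧ (i ℚ./ n)          <⟨ ℤ.*-monoʳ-<-pos (↧ (i ℚ./ n)) i<kn ⟩
  k ℤ.* + n ℤ.* ↧ (i ℚ./ n)  ≡⟨ swap k (+ n) (↧ (i ℚ./ n)) ⟩
  k ℤ.* ↧ (i ℚ./ n) ℤ.* + n  ∎)
  where
  open ℤ.≤-Reasoning
  swap : ∀ a b c → a ℤ.* b ℤ.* c ≡ a ℤ.* c ℤ.* b
  swap = ℤ.solve-∀

↥<k*↧⇒floor<k : ∀ p k → ↥ p ℤ.< k ℤ.* ↧ p → floor p ℤ.< k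
↥<k*↧⇒floor<k p@(mkℚ _ _ _) k ↥p<k↧p = ℤ.*-cancelʳ-<-nonNeg (↧ p) (ℤ.≤-<-trans floor*↧≤↥ ↥p<k↧p)
  where
  floor*↧≤↥ : floor p ℤ.* ↧ p ℤ.≤ ↥ p
  floor*↧≤↥ = ℤ.≤-trans (ℤ.i≤j+i _ (+ (↥ p ℤ.% ↧ p))) (ℤ.≤-reflexive (sym (ℤ.a≡a%n+[a/n]*n (↥ p) (↧ p))))

-- p + 1ℚ unfolds to the unreduced fraction (↥ p + ↧ p) / ↧ p.
↥<k*↧⇒↥[p+1]<[1+k]*↧ : ∀ p k → ↥ p ℤ.< k ℤ.* ↧ p → ↥ (p ℚ.+ 1ℚ) ℤ.< ℤ.suc k ℤ.* ↧ (p ℚ.+ 1ℚ)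
↥<k*↧⇒↥[p+1]<[1+k]*↧ p@(mkℚ a d _) k ↥p<k↧p = i<k*n⇒↥[i/n]<k*↧[i/n] _ (suc d * 1) (ℤ.suc k) (begin-strict
  a ℤ.* + 1 ℤ.+ + 1 ℤ.* + suc d      ≡⟨ cong₂ ℤ._+_ (ℤ.*-identityʳ a) (ℤ.*-identityˡ (+ suc d)) ⟩
  a ℤ.+ + suc d                       <⟨ ℤ.+-monoˡ-< (+ suc d) ↥p<k↧p ⟩
  k ℤ.* + suc d ℤ.+ + suc d           ≡⟨ distrib k (+ suc d) ⟩
  ℤ.suc k ℤ.* (+ suc d ℤ.* + 1)       ∎)
  where
  open ℤ.≤-Reasoning
  distrib : ∀ a b → a ℤ.* b ℤ.+ b ≡ (+ 1 ℤ.+ a) ℤ.* (b ℤ.* + 1)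
  distrib = ℤ.solve-∀

floor[i/n+1]<1+k : ∀ i n .{{_ : NonZero n}} k → i ℤ.< k ℤ.* + n → floor (i ℚ./ n ℚ.+ 1ℚ) ℤ.< ℤ.suc k
floor[i/n+1]<1+k i n k i<kn = ↥<k*↧⇒floor<k (i ℚ./ n ℚ.+ 1ℚ) (ℤ.suc k)
  (↥<k*↧⇒↥[p+1]<[1+k]*↧ (i ℚ./ n) k (i<k*n⇒↥[i/n]<k*↧[i/n] i n k i<kn))

floor[avgDeg′+1]≤ : ∀ e v m → 1 ≤ m → (0 < v → 2 * e < m * v) → floor (avgDeg' e v ℚ.+ 1ℚ) ℤ.≤ + m
floor[avgDeg′+1]≤ e zero    m 1≤m _     = ℤ.+≤+ 1≤m
floor[avgDeg′+1]≤ e (suc v) m _   2e<mv =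
  ℤ.≤-trans (ℤ.i<j⇒i≤pred[j] (floor[i/n+1]<1+k (+ (2 * e)) (suc v) (+ m) 2e<m[1+v]))
            (ℤ.≤-reflexive (ℤ.pred-suc (+ m)))
  where
  2e<m[1+v] : + (2 * e) ℤ.< + m ℤ.* + suc v
  2e<m[1+v] = subst (+ (2 * e) ℤ.<_) (ℤ.pos-* m (suc v)) (ℤ.+<+ (2e<mv (s≤s z≤n)))

proposition6 : (G : Graph) → Connected G →
    (q : ℚ) → IsMAD G q →
    (r : ℕ) → IsFloorSqrt ((9 + 8 * |E| G) ∸ (8 * |V| G)) r →
    floor (q ℚ.+ 1ℚ) ℤ.≤ + ((3 + r) / 2)
proposition6 G conn _ ((H , refl) , _) r √N =
  floor[avgDeg′+1]≤ (countE (es H)) (countV (vs H)) m (m≥n⇒m/n>0 {3 + r} (s≤s (s≤s z≤n))) 2e<mv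
  where
  m = (3 + r) / 2
  2e<mv : 0 < countV (vs H) → 2 * countE (es H) < m * countV (vs H)
  2e<mv 0<v with 0<countV⇒∃true (vs H) 0<v
  ... | a , a∈H = 2e<m*v m √N (≤[m/2]*2+1 (3 + r)) 0<v (n≤|E|+1 G conn a)
    (subgraph-e+n≤|E|+v G conn H a∈H) (subgraph-2e+v≤v² H)
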